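{- Let $N$ and $v$ be integers with $2\le v\le N+1$, let $f=\lfloor\frac{N+1}{v}\rfloor$ and $d=(f+1)v-N$. Then the total number of shapes (with multiplicity) in the $v$-type $\mathcal L(N,v)$ equals \[\Lambda(N,v)=\Big\lfloor\tfrac{1}{d}\sum_{i=f-d+2}^{f}(f+1-i)\tbinom{N}{i}\Big\rfloor+\sum_{i=0}^{f-d+1}\tbinom{N}{i}.\]
   Context: Binomial coefficients with negative lower index are $0$; empty sums are $0$. A $v$-shape is a multiset of $v$ nonnegative integers. For $0\le i\le f$, $L_i(N,v)$ is the $v$-shape consisting of the entry $i$ together with $v-1$ further entries that sum to $N-i$ and pairwise differ by at most $1$. If $v\ge3$ and $N\equiv v-1\pmod v$, $L_*(N,v)$ is the $v$-shape with two entries $f-1$, $v-3$ entries $f$ and one entry $f+1$. Let $s=\sum_{i=f-d+2}^{f-1}(d-f-1+i)\binom{N}{i}$ and $s'=\sum_{i=f-v+1}^{f-2}(v-f+i)\binom{N}{i}$. The $v$-type $\mathcal L(N,v)$ is the multiset consisting of: $\binom{N}{i}$ copies of $L_i(N,v)$ for $0\le i\le f-2$; if $N\not\equiv v-1\pmod v$, additionally $\binom{N}{f-1}$ copies of $L_{f-1}(N,v)$ and $\lfloor\frac1d(\binom{N}{f}-s)\rfloor$ copies of $L_f(N,v)$; if $N\equiv v-1\pmod v$, additionally $\binom{N}{f-1}-2\lceil\frac{s'}{v+1}\rceil$ copies of $L_{f-1}(N,v)$ and $\lceil\frac{s'}{v+1}\rceil$ copies of $L_*(N,v)$. Its size is the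 sum of these multiplicities. -}

module Defs where

open import Data.Nat as ℕ using (ℕ; zero; suc)
import Data.Nat.DivMod as ℕD
open import Data.Nat.Combinatorics using (_C_)
open import Data.Integer as ℤ using (ℤ; +_; -[1+_]; 0ℤ; 1ℤ; _⊔_; ∣_∣; _/ℕ_)
open import Data.List using (List; []; _∷_; map; upTo; replicate; _++_; foldr)
open import Data.Product using (_×_; _,_; proj₁)
open import Data.Bool using (if_then_else_)
open import Relation.Nullary using (does)

binom : ℕ → ℤ → ℤ
binom N (+ i)    = + (N C i)
binom N -[1+ _ ] = 0ℤ

rangeℤ : ℤ → ℤ → List ℤ
rangeℤ a b = map (λ k → a ℤ.+ + k) (upTo ∣ (b ℤ.+ 1ℤ ℤ.- a) ⊔ 0ℤ ∣)

sumℤ : ℤ → ℤ → (ℤ → ℤ) → ℤ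
sumℤ a b g = foldr (λ i acc → g i ℤ.+ acc) 0ℤ (rangeℤ a b)

floorDiv : ℤ → ℕ → ℤ
floorDiv x zero    = 0ℤ
floorDiv x (suc k) = x /ℕ suc k

ceilDiv : ℤ → ℕ → ℤ
ceilDiv x d = ℤ.- floorDiv (ℤ.- x) d

fOf : ℕ → ℕ → ℕ
fOf N zero    = 0
fOf N (suc k) = suc N ℕD./ suc k

dOf : ℕ → ℕ → ℤ
dOf N v = + ((suc (fOf N v)) ℕ.* v) ℤ.- + N

dℕ : ℕ → ℕ → ℕ
dℕ N v = ∣ dOf N v ∣

modOf : ℕ → ℕ → ℕ
modOf N zero    = N
modOf N (suc k) = N ℕD.% suc k

Special : ℕ → ℕ → Set
Special N v = modOf N v ≡ v ℕ.∸ 1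
  where open import Relation.Binary.PropositionalEquality using (_≡_)

special? : (N v : ℕ) → Relation.Nullary.Dec (Special N v)
special? N v = modOf N v ℕ.≟ (v ℕ.∸ 1)

-- A v-shape: a multiset of v nonnegative integers, represented as a list.
Shape : Set
Shape = List ℕ

-- A v-type: a multiset of shapes, represented as a list of
-- (multiplicity, shape) pairs.
VType : Set
VType = List (ℤ × Shape)

size : VType → ℤ
size t = foldr (λ p acc → proj₁ p ℤ.+ acc) 0ℤ t

copiesOf : ℕ → ℕ → Shape
copiesOf m x = replicate m x

-- L_i(N,v): entry i plus v-1 entries summing to N-i, pairwise differing by ≤ 1:
-- with N-i = q(v-1) + r, 0 ≤ r < v-1: r entries q+1 and (v-1-r) entries q.
Lshape : ℕ → ℕ → ℕ → Shape
Lshape N v i with v ℕ.∸ 1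
... | zero  = i ∷ []
... | suc w = i ∷ (copiesOf r (suc q) ++ copiesOf (suc w ℕ.∸ r) q)
  where
    q = (N ℕ.∸ i) ℕD./ suc w
    r = (N ℕ.∸ i) ℕD.% suc w

Lstar : ℕ → ℕ → Shape
Lstar N v = copiesOf 2 (f ℕ.∸ 1) ++ copiesOf (v ℕ.∸ 3) f ++ (suc f ∷ [])
  where f = fOf N v

sOf : ℕ → ℕ → ℤ
sOf N v = sumℤ (f ℤ.- d ℤ.+ + 2) (f ℤ.- 1ℤ)
               (λ i → (d ℤ.- f ℤ.- 1ℤ ℤ.+ i) ℤ.* binom N i)
  where f = + fOf N v ; d = dOf N v

s'Of : ℕ → ℕ → ℤ
s'Of N v = sumℤ (f ℤ.- + v ℤ.+ 1ℤ) (f ℤ.- + 2)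
                (λ i → (+ v ℤ.- f ℤ.+ i) ℤ.* binom N i)
  where f = + fOf N v

𝓛 : ℕ → ℕ → VType
𝓛 N v = map (λ i → (+ (N C i) , Lshape N v i)) (upTo (f ℕ.∸ 1))
        ++ (if does (special? N v) then specialPart else genericPart)
  where
    f = fOf N v
    genericPart : VType
    genericPart = (binom N (+ f ℤ.- 1ℤ) , Lshape N v (f ℕ.∸ 1))
                ∷ (floorDiv (+ (N C f) ℤ.- sOf N v) (dℕ N v) , Lshape N v f)
                ∷ []
    c : ℤ
    c = ceilDiv (s'Of N v) (suc v)
    specialPart : VType
    specialPart = (binom N (+ f ℤ.- 1ℤ) ℤ.- + 2 ℤ.* c , Lshape N v (f ℕ.∸ 1))
                ∷ (c , Lstar N v)
                ∷ []

Λ : ℕ → ℕ → ℤ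
Λ N v = floorDiv (sumℤ (f ℤ.- d ℤ.+ + 2) f (λ i → (f ℤ.+ 1ℤ ℤ.- i) ℤ.* binom N i)) (dℕ N v)
        ℤ.+ sumℤ 0ℤ (f ℤ.- d ℤ.+ 1ℤ) (binom N)
  where f = + fOf N v ; d = dOf N v

-- In both branches 𝓛(N,v) has size Σ_{i<f} C(N,i) + ⌊(C(N,f) − s)/d⌋. For the special branch,
-- N + 1 = f v forces d = v + 1 and C(N,f) = (v − 1) C(N,f−1), so s is s′ plus its top term
-- (d − 2) C(N,f−1) = C(N,f); thus C(N,f) − s = −s′ and −⌈s′/(v+1)⌉ = ⌊(C(N,f) − s)/d⌋.
-- Moving the integer Σ_{i<f} C(N,i) inside the floor, it remains to check
--   d Σ_{i<f} C(N,i) + C(N,f) − s = T + d P,   T = Σ_{i=f−d+2}^{f} (f+1−i) C(N,i),  P = Σ_{i≤f−d+1} C(N,i),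
-- which holds because the weights d−f−1+i of s and f+1−i of T add up to d; it uses nothing about
-- the binomials except that they vanish at negative indices.
module Submission where

open import Data.Bool using (true; false; if_then_else_)
open import Data.Integer using (ℤ; +_; -[1+_]; 0ℤ; 1ℤ; ∣_∣; _/ℕ_; _+_; _-_; _*_; -_; +≤+)
import Data.Integer as ℤ
open import Data.Integer.DivMod using ([n/ℕd]*d≤n; n<s[n/ℕd]*d)
import Data.Integer.Properties as ℤ
open import Data.Integer.Tactic.RingSolver using (solve-∀)
open import Data.List using ([]; _∷_; _++_; foldr; map; upTo; applyUpTo)
open import Data.List.Properties using (foldr-map; map-upTo)
open import Data.Nat using (ℕ; zero; suc; _≤_; s≤s; z≤n; _!)
import Data.Nat as ℕ
open import Data.Nat.Combinatorics
  using (_C_; nCk≡n!/k![n-k]!; k![n∸k]!∣n!; k>n⇒nCk≡0; [n-k]*d[k+1]≡[k+1]*d[k])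
import Data.Nat.DivMod as ℕ
import Data.Nat.Properties as ℕ
open import Data.Nat.Tactic.RingSolver using () renaming (solve-∀ to ℕ-solve-∀)
open import Data.Product using (_,_; proj₁)
open import Function using (_∘_)
open import Relation.Binary.PropositionalEquality
open import Relation.Nullary using (yes; no; ¬_)
open import Relation.Nullary.Decidable using (dec-true; dec-false)

open import Defs

open ≡-Reasoning

sumFrom : ℤ → ℕ → (ℤ → ℤ) → ℤ
sumFrom a zero    g = 0ℤ
sumFrom a (suc n) g = g a + sumFrom (a + 1ℤ) n g

sumFrom-++ : ∀ a m n g → sumFrom a (m ℕ.+ n) g ≡ sumFrom a m g + sumFrom (a + + m) n g
sumFrom-++ a zero n g = begin
  sumFrom a n g               ≡⟨ cong (λ b → sumFrom b n g) (ℤ.+-identityʳ a) ⟨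
  sumFrom (a + + 0) n g       ≡⟨ ℤ.+-identityˡ _ ⟨
  0ℤ + sumFrom (a + + 0) n g  ∎
sumFrom-++ a (suc m) n g = begin
  g a + sumFrom (a + 1ℤ) (m ℕ.+ n) g                         ≡⟨ cong (λ s → g a + s) (sumFrom-++ (a + 1ℤ) m n g) ⟩
  g a + (sumFrom (a + 1ℤ) m g + sumFrom (a + 1ℤ + + m) n g)  ≡⟨ ℤ.+-assoc (g a) _ _ ⟨
  sumFrom a (suc m) g + sumFrom (a + 1ℤ + + m) n g           ≡⟨ cong (λ b → sumFrom a (suc m) g + sumFrom b n g) (ℤ.+-assoc a 1ℤ (+ m)) ⟩
  sumFrom a (suc m) g + sumFrom (a + + suc m) n g            ∎

sumFrom-suc : ∀ a n g → sumFrom a (suc n) g ≡ sumFrom a n g + g (a + + n)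
sumFrom-suc a n g = begin
  sumFrom a (suc n) g                    ≡⟨ cong (λ k → sumFrom a k g) (ℕ.+-comm 1 n) ⟩
  sumFrom a (n ℕ.+ 1) g                  ≡⟨ sumFrom-++ a n 1 g ⟩
  sumFrom a n g + (g (a + + n) + 0ℤ)     ≡⟨ cong (λ s → sumFrom a n g + s) (ℤ.+-identityʳ _) ⟩
  sumFrom a n g + g (a + + n)            ∎

sumFrom-cong : ∀ a n {g h} → (∀ i → g i ≡ h i) → sumFrom a n g ≡ sumFrom a n h
sumFrom-cong a zero    g≗h = refl
sumFrom-cong a (suc n) g≗h = cong₂ _+_ (g≗h a) (sumFrom-cong (a + 1ℤ) n g≗h)

sumFrom-+ : ∀ a n g h → sumFrom a n (λ i → g i + h i) ≡ sumFrom a n g + sumFrom a n h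
sumFrom-+ a zero    g h = refl
sumFrom-+ a (suc n) g h rewrite sumFrom-+ (a + 1ℤ) n g h =
  interchange (g a) (h a) (sumFrom (a + 1ℤ) n g) (sumFrom (a + 1ℤ) n h)
  where
  interchange : ∀ x y z w → x + y + (z + w) ≡ x + z + (y + w)
  interchange = solve-∀

sumFrom-*ˡ : ∀ a n c g → sumFrom a n (λ i → c * g i) ≡ c * sumFrom a n g
sumFrom-*ˡ a zero    c g = sym (ℤ.*-zeroʳ c)
sumFrom-*ˡ a (suc n) c g rewrite sumFrom-*ˡ (a + 1ℤ) n c g = sym (ℤ.*-distribˡ-+ c (g a) _)

VanishesOnNegatives : (ℤ → ℤ) → Set
VanishesOnNegatives g = ∀ n → g -[1+ n ] ≡ 0ℤ

sumFrom-negatives : ∀ g → VanishesOnNegatives g → ∀ k → sumFrom -[1+ k ] (suc k) g ≡ 0ℤ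
sumFrom-negatives g g<0≡0 zero    = trans (ℤ.+-identityʳ _) (g<0≡0 0)
sumFrom-negatives g g<0≡0 (suc k) = cong₂ _+_ (g<0≡0 (suc k)) (sumFrom-negatives g g<0≡0 k)

foldr-applyUpTo : ∀ {A : Set} (h : A → ℤ) (φ : ℕ → A) g a n → (∀ k → h (φ k) ≡ g (a + + k)) →
                  foldr (λ x s → h x + s) 0ℤ (applyUpTo φ n) ≡ sumFrom a n g
foldr-applyUpTo h φ g a zero    hφ≡g = refl
foldr-applyUpTo h φ g a (suc n) hφ≡g = cong₂ _+_
  (trans (hφ≡g 0) (cong g (ℤ.+-identityʳ a)))
  (foldr-applyUpTo h (φ ∘ suc) g (a + 1ℤ) n (λ k → trans (hφ≡g (suc k)) (cong g (sym (ℤ.+-assoc a 1ℤ (+ k))))))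

sumℤ≡sumFrom : ∀ a b n g → b + 1ℤ - a ≡ + n → sumℤ a b g ≡ sumFrom a n g
sumℤ≡sumFrom a b n g length≡n = begin
  foldr (λ i s → g i + s) 0ℤ (map (λ k → a + + k) (upTo ∣ (b + 1ℤ - a) ℤ.⊔ 0ℤ ∣))
    ≡⟨ cong (λ m → foldr (λ i s → g i + s) 0ℤ (map (λ k → a + + k) (upTo m))) count≡n ⟩
  foldr (λ i s → g i + s) 0ℤ (map (λ k → a + + k) (upTo n))
    ≡⟨ cong (foldr (λ i s → g i + s) 0ℤ) (map-upTo (λ k → a + + k) n) ⟩
  foldr (λ i s → g i + s) 0ℤ (applyUpTo (λ k → a + + k) n)
    ≡⟨ foldr-applyUpTo g (λ k → a + + k) g a n (λ _ → refl) ⟩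
  sumFrom a n g ∎
  where
  count≡n : ∣ (b + 1ℤ - a) ℤ.⊔ 0ℤ ∣ ≡ n
  count≡n rewrite length≡n = ℕ.⊔-identityʳ n

sumℤ-upTo : ∀ f g → sumℤ 0ℤ (+ f - 1ℤ) g ≡ sumFrom 0ℤ f g
sumℤ-upTo f g = sumℤ≡sumFrom 0ℤ (+ f - 1ℤ) f g (length (+ f))
  where
  length : ∀ F → F - 1ℤ + 1ℤ - 0ℤ ≡ F
  length = solve-∀

sumFrom-pred+ : ∀ g f → 1 ≤ f → ∀ y → sumFrom 0ℤ (f ℕ.∸ 1) g + (g (+ f - 1ℤ) + y) ≡ sumℤ 0ℤ (+ f - 1ℤ) g + y
sumFrom-pred+ g (suc k) _ y = begin
  sumFrom 0ℤ k g + (g (+ k) + y)   ≡⟨ ℤ.+-assoc (sumFrom 0ℤ k g) (g (+ k)) y ⟨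
  sumFrom 0ℤ k g + g (+ k) + y     ≡⟨ cong (_+ y) (sumFrom-suc 0ℤ k g) ⟨
  sumFrom 0ℤ (suc k) g + y         ≡⟨ cong (_+ y) (sumℤ-upTo (suc k) g) ⟨
  sumℤ 0ℤ (+ k) g + y              ∎

sumFrom-split : ∀ g → VanishesOnNegatives g → ∀ m e f → m + + e ≡ + f →
                sumFrom 0ℤ f g ≡ sumℤ 0ℤ (m - 1ℤ) g + sumFrom m e g
sumFrom-split g g<0≡0 (+ k) e f m+e≡f = begin
  sumFrom 0ℤ f g                          ≡⟨ cong (λ n → sumFrom 0ℤ n g) (ℤ.+-injective m+e≡f) ⟨
  sumFrom 0ℤ (k ℕ.+ e) g                  ≡⟨ sumFrom-++ 0ℤ k e g ⟩
  sumFrom 0ℤ k g + sumFrom (+ k) e g      ≡⟨ cong (_+ sumFrom (+ k) e g) (sumℤ-upTo k g) ⟨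
  sumℤ 0ℤ (+ k - 1ℤ) g + sumFrom (+ k) e g ∎
sumFrom-split g g<0≡0 -[1+ k ] e f m+e≡f = begin
  sumFrom 0ℤ f g                                       ≡⟨ ℤ.+-identityˡ _ ⟨
  0ℤ + sumFrom 0ℤ f g                                  ≡⟨ cong (_+ sumFrom 0ℤ f g) (sumFrom-negatives g g<0≡0 k) ⟨
  sumFrom -[1+ k ] (suc k) g + sumFrom 0ℤ f g          ≡⟨ cong (λ a → sumFrom -[1+ k ] (suc k) g + sumFrom a f g) (ℤ.+-inverseˡ (+ suc k)) ⟨
  sumFrom -[1+ k ] (suc k) g + sumFrom (-[1+ k ] + + suc k) f g  ≡⟨ sumFrom-++ -[1+ k ] (suc k) f g ⟨
  sumFrom -[1+ k ] (suc k ℕ.+ f) g                     ≡⟨ cong (λ n → sumFrom -[1+ k ] n g) e≡1+k+f ⟨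
  sumFrom -[1+ k ] e g                                 ≡⟨ ℤ.+-identityˡ _ ⟨
  sumℤ 0ℤ (-[1+ k ] - 1ℤ) g + sumFrom -[1+ k ] e g     ∎
  where
  e≡1+k+f : e ≡ suc k ℕ.+ f
  e≡1+k+f = ℤ.+-injective (begin
    + e                            ≡⟨ cancel -[1+ k ] (+ e) ⟩
    + suc k + (-[1+ k ] + + e)     ≡⟨ cong (λ x → + suc k + x) m+e≡f ⟩
    + (suc k ℕ.+ f)                ∎)
    where
    cancel : ∀ M E → E ≡ - M + (M + E)
    cancel = solve-∀

i<suc[j]⇒i≤j : ∀ {i j} → i ℤ.< ℤ.suc j → i ℤ.≤ j
i<suc[j]⇒i≤j {i} {j} i<1+j = subst (i ℤ.≤_) (ℤ.pred-suc j) (ℤ.i<j⇒i≤pred[j] i<1+j)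

/ℕ-unique : ∀ i q d .{{_ : ℕ.NonZero d}} → q * + d ℤ.≤ i → i ℤ.< ℤ.suc q * + d → i /ℕ d ≡ q
/ℕ-unique i q d q*d≤i i<[1+q]*d = ℤ.≤-antisym
  (i<suc[j]⇒i≤j (ℤ.*-cancelʳ-<-nonNeg (+ d) (ℤ.≤-<-trans ([n/ℕd]*d≤n i d) i<[1+q]*d)))
  (i<suc[j]⇒i≤j (ℤ.*-cancelʳ-<-nonNeg (+ d) (ℤ.≤-<-trans q*d≤i (n<s[n/ℕd]*d i d))))

[i+j*d]/ℕd≡i/ℕd+j : ∀ i j d .{{_ : ℕ.NonZero d}} → (i + j * + d) /ℕ d ≡ i /ℕ d + j
[i+j*d]/ℕd≡i/ℕd+j i j d = /ℕ-unique (i + j * + d) (q + j) d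
  (subst (ℤ._≤ i + j * + d) (sym (ℤ.*-distribʳ-+ (+ d) q j))
         (ℤ.+-monoˡ-≤ (j * + d) ([n/ℕd]*d≤n i d)))
  (subst (i + j * + d ℤ.<_) (sym (distrib q j (+ d)))
         (ℤ.+-monoˡ-< (j * + d) (n<s[n/ℕd]*d i d)))
  where
  q = i /ℕ d
  distrib : ∀ q j d → (1ℤ + (q + j)) * d ≡ (1ℤ + q) * d + j * d
  distrib = solve-∀

nCk*k![n∸k]!≡n! : ∀ {n k} → k ≤ n → (n C k) ℕ.* (k ! ℕ.* (n ℕ.∸ k) !) ≡ n !
nCk*k![n∸k]!≡n! {n} {k} k≤n = begin
  (n C k) ℕ.* (k ! ℕ.* (n ℕ.∸ k) !)
    ≡⟨ cong (ℕ._* (k ! ℕ.* (n ℕ.∸ k) !)) (nCk≡n!/k![n-k]! k≤n) ⟩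
  ℕ._/_ (n !) (k ! ℕ.* (n ℕ.∸ k) !) {{ℕ._!*_!≢0 k (n ℕ.∸ k)}} ℕ.* (k ! ℕ.* (n ℕ.∸ k) !)
    ≡⟨ ℕ.m/n*n≡m {{ℕ._!*_!≢0 k (n ℕ.∸ k)}} (k![n∸k]!∣n! k≤n) ⟩
  n ! ∎

[1+k]*nC[1+k]≡[n∸k]*nCk : ∀ n k → suc k ℕ.* (n C suc k) ≡ (n ℕ.∸ k) ℕ.* (n C k)
[1+k]*nC[1+k]≡[n∸k]*nCk n k with k ℕ.<? n
... | no k≮n = begin
  suc k ℕ.* (n C suc k)    ≡⟨ cong (suc k ℕ.*_) (k>n⇒nCk≡0 (s≤s n≤k)) ⟩
  suc k ℕ.* 0              ≡⟨ ℕ.*-zeroʳ (suc k) ⟩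
  0                        ≡⟨ cong (ℕ._* (n C k)) (ℕ.m≤n⇒m∸n≡0 n≤k) ⟨
  (n ℕ.∸ k) ℕ.* (n C k)    ∎
  where n≤k = ℕ.≮⇒≥ k≮n
... | yes k<n = ℕ.*-cancelʳ-≡ _ _ d[k] {{ℕ._!*_!≢0 k (n ℕ.∸ k)}} (begin
  suc k ℕ.* (n C suc k) ℕ.* d[k]             ≡⟨ ℕ.*-assoc (suc k) (n C suc k) d[k] ⟩
  suc k ℕ.* ((n C suc k) ℕ.* d[k])           ≡⟨ exchange (suc k) (n C suc k) d[k] ⟩
  (n C suc k) ℕ.* (suc k ℕ.* d[k])           ≡⟨ cong ((n C suc k) ℕ.*_) ([n-k]*d[k+1]≡[k+1]*d[k] k<n) ⟨
  (n C suc k) ℕ.* ((n ℕ.∸ k) ℕ.* d[k+1])     ≡⟨ exchange (n ℕ.∸ k) (n C suc k) d[k+1] ⟨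
  (n ℕ.∸ k) ℕ.* ((n C suc k) ℕ.* d[k+1])     ≡⟨ cong ((n ℕ.∸ k) ℕ.*_) (nCk*k![n∸k]!≡n! k<n) ⟩
  (n ℕ.∸ k) ℕ.* n !                           ≡⟨ cong ((n ℕ.∸ k) ℕ.*_) (nCk*k![n∸k]!≡n! (ℕ.<⇒≤ k<n)) ⟨
  (n ℕ.∸ k) ℕ.* ((n C k) ℕ.* d[k])           ≡⟨ ℕ.*-assoc (n ℕ.∸ k) (n C k) d[k] ⟨
  (n ℕ.∸ k) ℕ.* (n C k) ℕ.* d[k]             ∎)
  where
  d[k] = k ! ℕ.* (n ℕ.∸ k) !
  d[k+1] = suc k ! ℕ.* (n ℕ.∸ suc k) !
  exchange : ∀ a b c → a ℕ.* (b ℕ.* c) ≡ b ℕ.* (a ℕ.* c)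
  exchange = ℕ-solve-∀

numerator-identity : ∀ g → VanishesOnNegatives g → ∀ f D → + 2 ℤ.≤ D →
  g (+ f) - sumℤ (+ f - D + + 2) (+ f - 1ℤ) (λ i → (D - + f - 1ℤ + i) * g i) + sumℤ 0ℤ (+ f - 1ℤ) g * D
  ≡ sumℤ (+ f - D + + 2) (+ f) (λ i → (+ f + 1ℤ - i) * g i) + sumℤ 0ℤ (+ f - D + 1ℤ) g * D
numerator-identity g g<0≡0 f D@(+ suc (suc e)) (+≤+ (s≤s (s≤s z≤n))) = begin
  g F - s + Σ * D              ≡⟨ cong₂ (λ x y → g F - x + y * D) s≡S Σ≡P+A ⟩
  g F - S + (P + A) * D        ≡⟨ expand (g F) S P A D ⟩
  g F - S + P * D + D * A      ≡⟨ cong (λ x → g F - S + P * D + x) Tₑ+S≡D*A ⟨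
  g F - S + P * D + (Tₑ + S)   ≡⟨ cancel (g F) S P Tₑ D ⟩
  Tₑ + g F + P * D             ≡⟨ cong (_+ P * D) T≡Tₑ+gF ⟨
  T + P * D                    ∎
  where
  F m : ℤ
  F = + f
  m = F - D + + 2
  hs hT : ℤ → ℤ
  hs i = (D - F - 1ℤ + i) * g i
  hT i = (F + 1ℤ - i) * g i
  Σ = sumℤ 0ℤ (F - 1ℤ) g
  s = sumℤ m (F - 1ℤ) hs
  T = sumℤ m F hT
  P = sumℤ 0ℤ (F - D + 1ℤ) g
  A = sumFrom m e g
  S = sumFrom m e hs
  Tₑ = sumFrom m e hT
  expand : ∀ x S P A D → x - S + (P + A) * D ≡ x - S + P * D + D * A
  expand = solve-∀
  cancel : ∀ x S P Tₑ D → x - S + P * D + (Tₑ + S) ≡ Tₑ + x + P * D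
  cancel = solve-∀
  m+e≡F : m + + e ≡ F
  m+e≡F = bounds F (+ e)
    where bounds : ∀ F E → F - (+ 2 + E) + + 2 + E ≡ F
          bounds = solve-∀
  Σ≡P+A : Σ ≡ P + A
  Σ≡P+A = begin
    Σ                              ≡⟨ sumℤ-upTo f g ⟩
    sumFrom 0ℤ f g                 ≡⟨ sumFrom-split g g<0≡0 m e f m+e≡F ⟩
    sumℤ 0ℤ (m - 1ℤ) g + A         ≡⟨ cong (λ b → sumℤ 0ℤ b g + A) (bounds F D) ⟩
    P + A                          ∎
    where bounds : ∀ F D → F - D + + 2 - 1ℤ ≡ F - D + 1ℤ
          bounds = solve-∀
  s≡S : s ≡ S
  s≡S = sumℤ≡sumFrom m (F - 1ℤ) e hs (length F (+ e))
    where length : ∀ F E → F - 1ℤ + 1ℤ - (F - (+ 2 + E) + + 2) ≡ E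
          length = solve-∀
  T≡Tₑ+gF : T ≡ Tₑ + g F
  T≡Tₑ+gF = begin
    T                     ≡⟨ sumℤ≡sumFrom m F (suc e) hT (length F (+ e)) ⟩
    sumFrom m (suc e) hT  ≡⟨ sumFrom-suc m e hT ⟩
    Tₑ + hT (m + + e)     ≡⟨ cong (λ i → Tₑ + hT i) m+e≡F ⟩
    Tₑ + hT F             ≡⟨ cong (λ x → Tₑ + x) (top-weight F (g F)) ⟩
    Tₑ + g F              ∎
    where length : ∀ F E → F + 1ℤ - (F - (+ 2 + E) + + 2) ≡ 1ℤ + E
          length = solve-∀
          top-weight : ∀ F x → (F + 1ℤ - F) * x ≡ x
          top-weight = solve-∀
  Tₑ+S≡D*A : Tₑ + S ≡ D * A
  Tₑ+S≡D*A = begin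
    Tₑ + S                                  ≡⟨ sumFrom-+ m e hT hs ⟨
    sumFrom m e (λ i → hT i + hs i)         ≡⟨ sumFrom-cong m e (λ i → weights F D i (g i)) ⟩
    sumFrom m e (λ i → D * g i)             ≡⟨ sumFrom-*ˡ m e D g ⟩
    D * A                                   ∎
    where weights : ∀ F D i x → (F + 1ℤ - i) * x + (D - F - 1ℤ + i) * x ≡ D * x
          weights = solve-∀

floorDiv-identity : ∀ g → VanishesOnNegatives g → ∀ f D → + 2 ℤ.≤ D →
  sumℤ 0ℤ (+ f - 1ℤ) g
    + floorDiv (g (+ f) - sumℤ (+ f - D + + 2) (+ f - 1ℤ) (λ i → (D - + f - 1ℤ + i) * g i)) ∣ D ∣
  ≡ floorDiv (sumℤ (+ f - D + + 2) (+ f) (λ i → (+ f + 1ℤ - i) * g i)) ∣ D ∣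
    + sumℤ 0ℤ (+ f - D + 1ℤ) g
floorDiv-identity g g<0≡0 f D@(+ d) 2≤D@(+≤+ (s≤s (s≤s z≤n))) = begin
  Σ + (x - s) /ℕ d          ≡⟨ ℤ.+-comm Σ _ ⟩
  (x - s) /ℕ d + Σ          ≡⟨ [i+j*d]/ℕd≡i/ℕd+j (x - s) Σ d ⟨
  (x - s + Σ * D) /ℕ d      ≡⟨ cong (_/ℕ d) (numerator-identity g g<0≡0 f D 2≤D) ⟩
  (T + P * D) /ℕ d          ≡⟨ [i+j*d]/ℕd≡i/ℕd+j T P d ⟩
  T /ℕ d + P                ∎
  where
  x = g (+ f)
  Σ = sumℤ 0ℤ (+ f - 1ℤ) g
  s = sumℤ (+ f - D + + 2) (+ f - 1ℤ) (λ i → (D - + f - 1ℤ + i) * g i)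
  T = sumℤ (+ f - D + + 2) (+ f) (λ i → (+ f + 1ℤ - i) * g i)
  P = sumℤ 0ℤ (+ f - D + 1ℤ) g

s≡s′+last : ∀ (g : ℤ → ℤ) F v D → 2 ≤ v → D ≡ + suc v →
  sumℤ (F - D + + 2) (F - 1ℤ) (λ i → (D - F - 1ℤ + i) * g i)
  ≡ sumℤ (F - + v + 1ℤ) (F - + 2) (λ i → (+ v - F + i) * g i) + (D - + 2) * g (F - 1ℤ)
s≡s′+last g F (suc (suc w)) D (s≤s (s≤s z≤n)) refl = begin
  sumℤ (F - D + + 2) (F - 1ℤ) hs   ≡⟨ sumℤ≡sumFrom (F - D + + 2) (F - 1ℤ) (suc w) hs (length-s F (+ w)) ⟩
  sumFrom (F - D + + 2) (suc w) hs ≡⟨ cong (λ a → sumFrom a (suc w) hs) (bounds F (+ w)) ⟩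
  sumFrom a (suc w) hs             ≡⟨ sumFrom-suc a w hs ⟩
  sumFrom a w hs + hs (a + + w)    ≡⟨ cong₂ _+_ (sumFrom-cong a w (λ i → weights F (+ w) i (g i))) (cong hs (last-index F (+ w))) ⟩
  sumFrom a w hs′ + hs (F - 1ℤ)    ≡⟨ cong (λ x → sumFrom a w hs′ + x) (last-weight F D (g (F - 1ℤ))) ⟩
  sumFrom a w hs′ + (D - + 2) * g (F - 1ℤ) ≡⟨ cong (_+ (D - + 2) * g (F - 1ℤ)) (sumℤ≡sumFrom a (F - + 2) w hs′ (length-s′ F (+ w))) ⟨
  sumℤ a (F - + 2) hs′ + (D - + 2) * g (F - 1ℤ) ∎
  where
  a : ℤ
  a = F - + suc (suc w) + 1ℤ
  hs hs′ : ℤ → ℤ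
  hs i = (D - F - 1ℤ + i) * g i
  hs′ i = (+ suc (suc w) - F + i) * g i
  length-s : ∀ F W → F - 1ℤ + 1ℤ - (F - (+ 3 + W) + + 2) ≡ 1ℤ + W
  length-s = solve-∀
  bounds : ∀ F W → F - (+ 3 + W) + + 2 ≡ F - (+ 2 + W) + 1ℤ
  bounds = solve-∀
  weights : ∀ F W i x → (+ 3 + W - F - 1ℤ + i) * x ≡ (+ 2 + W - F + i) * x
  weights = solve-∀
  last-index : ∀ F W → F - (+ 2 + W) + 1ℤ + W ≡ F - 1ℤ
  last-index = solve-∀
  length-s′ : ∀ F W → F - + 2 + 1ℤ - (F - (+ 2 + W) + 1ℤ) ≡ W
  length-s′ = solve-∀
  last-weight : ∀ F D x → (D - F - 1ℤ + (F - 1ℤ)) * x ≡ (D - + 2) * x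
  last-weight = solve-∀

[d-2]*C[N,f-1]≡C[N,f] : ∀ N f u → suc N ≡ f ℕ.* suc u →
  (+ suc (suc u) - + 2) * binom N (+ f - 1ℤ) ≡ + (N C f)
[d-2]*C[N,f-1]≡C[N,f] N (suc g) u 1+N≡f*v = begin
  + u * + (N C g)      ≡⟨ ℤ.pos-* u (N C g) ⟨
  + (u ℕ.* (N C g))    ≡⟨ cong +_ (ℕ.*-cancelˡ-≡ _ _ (suc g) binomial) ⟨
  + (N C suc g)        ∎
  where
  N≡g+[1+g]*u : N ≡ g ℕ.+ suc g ℕ.* u
  N≡g+[1+g]*u = ℕ.suc-injective (trans 1+N≡f*v (expand g u))
    where expand : ∀ g u → suc g ℕ.* suc u ≡ suc (g ℕ.+ suc g ℕ.* u)
          expand = ℕ-solve-∀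
  binomial : suc g ℕ.* (N C suc g) ≡ suc g ℕ.* (u ℕ.* (N C g))
  binomial = begin
    suc g ℕ.* (N C suc g)         ≡⟨ [1+k]*nC[1+k]≡[n∸k]*nCk N g ⟩
    (N ℕ.∸ g) ℕ.* (N C g)         ≡⟨ cong (λ n → (n ℕ.∸ g) ℕ.* (N C g)) N≡g+[1+g]*u ⟩
    (g ℕ.+ suc g ℕ.* u ℕ.∸ g) ℕ.* (N C g) ≡⟨ cong (ℕ._* (N C g)) (ℕ.m+n∸m≡n g (suc g ℕ.* u)) ⟩
    suc g ℕ.* u ℕ.* (N C g)       ≡⟨ ℕ.*-assoc (suc g) u (N C g) ⟩
    suc g ℕ.* (u ℕ.* (N C g))     ∎

fOf≥1 : ∀ N v → 1 ≤ v → v ≤ suc N → 1 ≤ fOf N v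
fOf≥1 N (suc _) _ v≤1+N = ℕ.m≥n⇒m/n>0 v≤1+N

dOf≥2 : ∀ N v → 1 ≤ v → + 2 ℤ.≤ dOf N v
dOf≥2 N v@(suc _) _ with ℕ.m≤n⇒∃[o]m+o≡n 1+N<[1+f]*v
  where
  f = fOf N v
  1+N<[1+f]*v : suc N ℕ.< suc f ℕ.* v
  1+N<[1+f]*v = subst (ℕ._< suc f ℕ.* v) (sym (ℕ.m≡m%n+[m/n]*n (suc N) v))
                      (ℕ.+-monoˡ-< (f ℕ.* v) (ℕ.m%n<n (suc N) v))
... | e , 2+N+e≡[1+f]*v = subst (+ 2 ℤ.≤_) d≡2+e (+≤+ (s≤s (s≤s z≤n)))
  where
  d≡2+e : + suc (suc e) ≡ dOf N v
  d≡2+e = begin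
    + 2 + + e                      ≡⟨ rearrange (+ N) (+ e) ⟩
    + (suc (suc N) ℕ.+ e) - + N    ≡⟨ cong (λ x → + x - + N) 2+N+e≡[1+f]*v ⟩
    dOf N v                        ∎
    where rearrange : ∀ N E → + 2 + E ≡ + 2 + N + E - N
          rearrange = solve-∀

special⇒1+N≡f*v : ∀ N v → 1 ≤ v → Special N v → suc N ≡ fOf N v ℕ.* v
special⇒1+N≡f*v N v@(suc _) _ N%v≡u = trans 1+N≡[1+q]*v (cong (ℕ._* v) (sym f≡1+q))
  where
  q = N ℕ./ v
  1+N≡[1+q]*v : suc N ≡ suc q ℕ.* v
  1+N≡[1+q]*v = cong suc (trans (ℕ.m≡m%n+[m/n]*n N v) (cong (ℕ._+ q ℕ.* v) N%v≡u))
  f≡1+q : fOf N v ≡ suc q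
  f≡1+q = trans (cong (ℕ._/ v) 1+N≡[1+q]*v) (ℕ.m*n/n≡m (suc q) v)

special⇒dOf≡1+v : ∀ N v → 1 ≤ v → Special N v → dOf N v ≡ + suc v
special⇒dOf≡1+v N v 1≤v special = begin
  + (v ℕ.+ fOf N v ℕ.* v) - + N   ≡⟨ cong (λ x → + (v ℕ.+ x) - + N) (special⇒1+N≡f*v N v 1≤v special) ⟨
  + v + (1ℤ + + N) - + N          ≡⟨ rearrange (+ v) (+ N) ⟩
  + suc v                         ∎
  where rearrange : ∀ V N → V + (1ℤ + N) - N ≡ 1ℤ + V
        rearrange = solve-∀

special-numerator : ∀ N v → 2 ≤ v → Special N v → + (N C fOf N v) - sOf N v ≡ - s'Of N v
special-numerator N v@(suc u) 2≤v special = begin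
  Cf - sOf N v                                          ≡⟨ cong (λ x → Cf - x) (s≡s′+last (binom N) F v (dOf N v) 2≤v d≡1+v) ⟩
  Cf - (s'Of N v + (dOf N v - + 2) * binom N (F - 1ℤ))  ≡⟨ cong (λ d → Cf - (s'Of N v + (d - + 2) * binom N (F - 1ℤ))) d≡1+v ⟩
  Cf - (s'Of N v + (+ suc v - + 2) * binom N (F - 1ℤ))  ≡⟨ cong (λ x → Cf - (s'Of N v + x)) ([d-2]*C[N,f-1]≡C[N,f] N f u 1+N≡f*v) ⟩
  Cf - (s'Of N v + Cf)                                  ≡⟨ cancel Cf (s'Of N v) ⟩
  - s'Of N v                                            ∎
  where
  f = fOf N v
  F = + f
  Cf = + (N C f)
  1+N≡f*v = special⇒1+N≡f*v N v (ℕ.<⇒≤ 2≤v) special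
  d≡1+v = special⇒dOf≡1+v N v (ℕ.<⇒≤ 2≤v) special
  cancel : ∀ c s′ → c - (s′ + c) ≡ - s′
  cancel = solve-∀

size-++ : ∀ xs ys → size (xs ++ ys) ≡ size xs + size ys
size-++ []       ys = sym (ℤ.+-identityˡ _)
size-++ (x ∷ xs) ys = trans (cong (λ s → proj₁ x + s) (size-++ xs ys)) (sym (ℤ.+-assoc (proj₁ x) _ _))

size-upTo : ∀ g (S : ℕ → Shape) m → size (map (λ i → (g (+ i) , S i)) (upTo m)) ≡ sumFrom 0ℤ m g
size-upTo g S m = trans (foldr-map _ _ 0ℤ (upTo m))
                        (foldr-applyUpTo (λ i → g (+ i)) (λ i → i) g 0ℤ m (λ _ → refl))

size-upTo++pair : ∀ g (S : ℕ → Shape) m x s y t →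
  size (map (λ i → (g (+ i) , S i)) (upTo m) ++ (x , s) ∷ (y , t) ∷ []) ≡ sumFrom 0ℤ m g + (x + y)
size-upTo++pair g S m x s y t = trans (size-++ (map (λ i → (g (+ i) , S i)) (upTo m)) _)
  (cong₂ _+_ (size-upTo g S m) (cong (λ z → x + z) (ℤ.+-identityʳ y)))

if-true : ∀ {A : Set} {b} {x y : A} → b ≡ true → (if b then x else y) ≡ x
if-true refl = refl

if-false : ∀ {A : Set} {b} {x y : A} → b ≡ false → (if b then x else y) ≡ y
if-false refl = refl

module _ (N v : ℕ) (2≤v : 2 ≤ v) (v≤1+N : v ≤ suc N) where

  private
    f : ℕ
    f = fOf N v
    B : ℤ → ℤ
    B = binom N
    Σ : ℤ
    Σ = sumℤ 0ℤ (+ f - 1ℤ) B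
    prefix : VType
    prefix = map (λ i → (B (+ i) , Lshape N v i)) (upTo (f ℕ.∸ 1))
    f≥1 : 1 ≤ f
    f≥1 = fOf≥1 N v (ℕ.<⇒≤ 2≤v) v≤1+N

  -- 𝓛 branches on does (special? N v) inside its body, out of reach of with; hence if-true/if-false.
  size-𝓛-generic : ¬ Special N v → size (𝓛 N v) ≡ Σ + floorDiv (+ (N C f) - sOf N v) (dℕ N v)
  size-𝓛-generic ¬special = begin
    size (𝓛 N v)                                ≡⟨ cong (λ t → size (prefix ++ t)) (if-false (dec-false (special? N v) ¬special)) ⟩
    size (prefix ++ _)                          ≡⟨ size-upTo++pair B (Lshape N v) (f ℕ.∸ 1) _ _ _ _ ⟩
    sumFrom 0ℤ (f ℕ.∸ 1) B + (B (+ f - 1ℤ) + _) ≡⟨ sumFrom-pred+ B f f≥1 _ ⟩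
    Σ + floorDiv (+ (N C f) - sOf N v) (dℕ N v) ∎

  size-𝓛-special : Special N v → size (𝓛 N v) ≡ Σ + floorDiv (+ (N C f) - sOf N v) (dℕ N v)
  size-𝓛-special special = begin
    size (𝓛 N v)                                        ≡⟨ cong (λ t → size (prefix ++ t)) (if-true (dec-true (special? N v) special)) ⟩
    size (prefix ++ _)                                  ≡⟨ size-upTo++pair B (Lshape N v) (f ℕ.∸ 1) _ _ _ _ ⟩
    sumFrom 0ℤ (f ℕ.∸ 1) B + (B (+ f - 1ℤ) - + 2 * c + c) ≡⟨ cong (λ x → sumFrom 0ℤ (f ℕ.∸ 1) B + x) (collect (B (+ f - 1ℤ)) c) ⟩
    sumFrom 0ℤ (f ℕ.∸ 1) B + (B (+ f - 1ℤ) + - c)       ≡⟨ sumFrom-pred+ B f f≥1 (- c) ⟩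
    Σ + - c                                             ≡⟨ cong (λ x → Σ + x) (ℤ.neg-involutive _) ⟩
    Σ + floorDiv (- s'Of N v) (suc v)                   ≡⟨ cong₂ (λ x d → Σ + floorDiv x d) (special-numerator N v 2≤v special) d≡1+v ⟨
    Σ + floorDiv (+ (N C f) - sOf N v) (dℕ N v)         ∎
    where
    c = ceilDiv (s'Of N v) (suc v)
    d≡1+v : dℕ N v ≡ suc v
    d≡1+v = cong ∣_∣ (special⇒dOf≡1+v N v (ℕ.<⇒≤ 2≤v) special)
    collect : ∀ b c → b - + 2 * c + c ≡ b + - c
    collect = solve-∀

  size-𝓛 : size (𝓛 N v) ≡ Σ + floorDiv (+ (N C f) - sOf N v) (dℕ N v)
  size-𝓛 with special? N v
  ... | yes special = size-𝓛-special special
  ... | no ¬special = size-𝓛-generic ¬special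

lemma3p3 : (N v : ℕ) → 2 ≤ v → v ≤ N Data.Nat.+ 1 → size (𝓛 N v) ≡ Λ N v
lemma3p3 N v 2≤v v≤N+1 = begin
  size (𝓛 N v)
    ≡⟨ size-𝓛 N v 2≤v (subst (v ≤_) (ℕ.+-comm N 1) v≤N+1) ⟩
  sumℤ 0ℤ (+ fOf N v - 1ℤ) (binom N) + floorDiv (+ (N C fOf N v) - sOf N v) (dℕ N v)
    ≡⟨ floorDiv-identity (binom N) (λ _ → refl) (fOf N v) (dOf N v) (dOf≥2 N v (ℕ.<⇒≤ 2≤v)) ⟩
  Λ N v ∎
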